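{- A hypergraph $H$ is quasi-eulerian if and only if it admits a decomposition into cycles, i.e. its edge set can be partitioned into sets each of which is the edge set of a cycle of $H$.
   Context: A hypergraph $H=(V,E)$ has a nonempty finite vertex set $V$ and a finite set $E$ of edges, each associated with a subset of $V$ (parallel edges allowed); hypergraphs are assumed to have no empty edges. A walk is $v_0e_1v_1\dots e_kv_k$ with $v_{i-1}\ne v_i$, $v_{i-1},v_i\in e_i$; anchors $v_0,\dots,v_k$; closed if $k\ge2$ and $v_0=v_k$; a strict trail if $e_1,\dots,e_k$ are pairwise distinct. A cycle is a closed walk $v_0e_1v_1\dots e_kv_0$ whose vertices $v_0,\dots,v_{k-1}$ are pairwise distinct and whose edges $e_1,\dots,e_k$ are pairwise distinct. An Euler family is a family of pairwise anchor-disjoint closed strict trails such that each edge lies in exactly one of them; $H$ is quasi-eulerian if it admits one. -}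

module Defs where

open import Data.Nat using (ℕ; _<_; _≤_)
open import Data.Fin using (Fin)
open import Data.Fin.Subset using (Subset; Nonempty) renaming (_∈_ to _∈ₛ_)
open import Data.List using (List; []; _∷_; map; length; take; lookup)
open import Data.List.Membership.Propositional using (_∈_)
open import Data.List.Relation.Unary.Unique.Propositional using (Unique)
open import Data.Product using (_×_; _,_; proj₁; proj₂; ∃)
open import Data.Empty using (⊥)
open import Relation.Binary.PropositionalEquality using (_≡_; _≢_)

-- A hypergraph: vertices Fin nV (nonempty), edges indexed by Fin nE
-- (parallel edges allowed), each edge a nonempty subset of the vertices.
record Hypergraph : Set where
  field
    nV        : ℕ
    nE        : ℕ
    V-nonempty : 0 < nV
    edge      : Fin nE → Subset nV
    edge-nonempty : ∀ e → Nonempty (edge e)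

module _ (H : Hypergraph) where
  open Hypergraph H

  Vertex : Set
  Vertex = Fin nV

  Edge : Set
  Edge = Fin nE

  -- A walk v₀ e₁ v₁ … e_k v_k is given by its start anchor v₀ and the list
  -- of steps (e₁ , v₁) … (e_k , v_k).
  record Walk : Set where
    constructor walk
    field
      start : Vertex
      steps : List (Edge × Vertex)

  data IsWalkFrom : Vertex → List (Edge × Vertex) → Set where
    done : ∀ {u} → IsWalkFrom u []
    step : ∀ {u e v s} → u ≢ v → u ∈ₛ edge e → v ∈ₛ edge e →
           IsWalkFrom v s → IsWalkFrom u ((e , v) ∷ s)

  IsWalk : Walk → Set
  IsWalk w = IsWalkFrom (Walk.start w) (Walk.steps w)

  anchors : Walk → List Vertex
  anchors w = Walk.start w ∷ map proj₂ (Walk.steps w)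

  edges : Walk → List Edge
  edges w = map proj₁ (Walk.steps w)

  len : Walk → ℕ
  len w = length (Walk.steps w)

  lastAnchorFrom : Vertex → List (Edge × Vertex) → Vertex
  lastAnchorFrom u [] = u
  lastAnchorFrom u ((e , v) ∷ s) = lastAnchorFrom v s

  lastAnchor : Walk → Vertex
  lastAnchor w = lastAnchorFrom (Walk.start w) (Walk.steps w)

  IsClosedWalk : Walk → Set
  IsClosedWalk w = IsWalk w × 2 ≤ len w × lastAnchor w ≡ Walk.start w

  IsClosedStrictTrail : Walk → Set
  IsClosedStrictTrail w = IsClosedWalk w × Unique (edges w)

  IsCycle : Walk → Set
  IsCycle w = IsClosedWalk w × Unique (take (len w) (anchors w)) × Unique (edges w)

  EachEdgeInExactlyOne : (F : List Walk) → Set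
  EachEdgeInExactlyOne F =
    ∀ (e : Edge) → ∃ λ (i : Fin (length F)) →
      e ∈ edges (lookup F i) × (∀ (j : Fin (length F)) → e ∈ edges (lookup F j) → j ≡ i)

  IsEulerFamily : List Walk → Set
  IsEulerFamily F =
    (∀ (i : Fin (length F)) → IsClosedStrictTrail (lookup F i)) ×
    (∀ (i j : Fin (length F)) → i ≢ j → ∀ (v : Vertex) →
        v ∈ anchors (lookup F i) → v ∈ anchors (lookup F j) → ⊥) ×
    EachEdgeInExactlyOne F

  QuasiEulerian : Set
  QuasiEulerian = ∃ λ (F : List Walk) → IsEulerFamily F

  IsCycleDecomposition : List Walk → Set
  IsCycleDecomposition C =
    (∀ (i : Fin (length C)) → IsCycle (lookup C i)) × EachEdgeInExactlyOne C

  HasCycleDecomposition : Set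
  HasCycleDecomposition = ∃ λ (C : List Walk) → IsCycleDecomposition C

-- Both properties say that E can be split into closed walks; the rest is surgery on walks.
-- If the anchors v₁ … v_k of a closed walk repeat, cutting out the segment between two
-- occurrences leaves two shorter closed walks, so every closed strict trail falls apart into
-- cycles. Conversely, two closed walks through a common anchor splice there into one closed
-- walk; splicing cycles together until no two share an anchor gives pairwise anchor-disjoint
-- closed walks, and their edges are distinct because those of the cycles partition E.
module Submission where

open import Defs
open import Function.Base using (_∘_)
open import Function.Bundles using (_⇔_; mk⇔)
open import Data.Nat using (_+_; _<_; _≤_; z≤n; s≤s)
open import Data.Nat.Induction using (<-wellFounded)
open import Induction.WellFounded using (Acc; acc)
open import Data.Nat.Properties using (≤-trans; m≤m+n; m<m+n; m<n+m; ≤-reflexive)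
open import Data.Fin as Fin using (zero; suc)
open import Data.Fin.Properties using (suc-injective)
open import Data.Product using (∃; _×_; _,_; proj₁; proj₂)
open import Data.Sum using (_⊎_; inj₁; inj₂)
open import Data.List using (List; []; _∷_; _++_; map; length; take; lookup; concatMap; [_])
open import Data.List.Properties using (length-++; map-++; ++-assoc; ++-identityʳ; concatMap-++; map-concatMap)
open import Data.List.Membership.Propositional using (_∈_; lose; find)
open import Data.List.Membership.Propositional.Properties
  using (∈-++⁺ˡ; ∈-++⁺ʳ; ∈-++⁻; ∈-concatMap⁺; ∈-concatMap⁻; ∈-lookup; ∈-map⁻; ∈-∃++)
open import Data.List.Relation.Unary.All as All using (All; []; _∷_)
open import Data.List.Relation.Unary.All.Properties as All using (¬Any⇒All¬)
open import Data.List.Relation.Unary.Any as Any using (Any; here; there; any?)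
open import Data.List.Relation.Unary.Any.Properties using (lookup-index)
open import Data.List.Relation.Unary.AllPairs using (AllPairs; []; _∷_)
open import Data.List.Relation.Unary.Unique.Propositional using (Unique)
import Data.List.Relation.Unary.Unique.Propositional.Properties as Unique
open import Data.List.Relation.Binary.Disjoint.Propositional using (Disjoint)
import Data.List.Relation.Binary.Disjoint.Propositional.Properties as Disjoint
open import Data.List.Relation.Binary.Subset.Propositional using (_⊆_)
import Data.List.Relation.Binary.Subset.Propositional.Properties as Subset
open Subset using (⊆-trans; ⊆-reflexive; ⊆-reflexive-↭)
open import Data.List.Relation.Binary.Permutation.Propositional
  using (_↭_; ↭-refl; ↭-sym; ↭-trans; ↭-reflexive; ↭-prep; ↭⇒↭ₛ; module PermutationReasoning)
open import Data.List.Relation.Binary.Permutation.Propositional.Properties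
  using (∈-resp-↭; ++-comm; ++⁺ˡ; ++⁺ʳ; ++⁺; shifts; ↭-length; drop-∷; ∷↭∷ʳ; map⁺)
import Data.List.Relation.Binary.Permutation.Setoid.Properties as Permutationₛ
open import Relation.Binary.Definitions using (Symmetric; DecidableEquality)
open import Relation.Binary.PropositionalEquality
  using (_≡_; _≢_; refl; sym; trans; cong; subst; setoid; module ≡-Reasoning)
open import Relation.Nullary using (yes; no; contradiction)

module _ {A : Set} where

  Unique-resp-↭ : {xs ys : List A} → xs ↭ ys → Unique xs → Unique ys
  Unique-resp-↭ xs↭ys = Permutationₛ.Unique-resp-↭ (setoid A) (↭⇒↭ₛ xs↭ys)

  Unique-++⁻ : ∀ xs {ys : List A} → Unique (xs ++ ys) → Unique xs × Unique ys × Disjoint xs ys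
  Unique-++⁻ [] !ys = [] , !ys , λ ()
  Unique-++⁻ (x ∷ xs) (x∉ ∷ !xs++ys) with Unique-++⁻ xs !xs++ys
  ... | !xs , !ys , xs#ys = All.++⁻ˡ xs x∉ ∷ !xs , !ys , x∷xs#ys
    where
    x∷xs#ys : Disjoint (x ∷ xs) _
    x∷xs#ys (here refl , v∈ys) = All.lookup (All.++⁻ʳ xs x∉) v∈ys refl
    x∷xs#ys (there v∈xs , v∈ys) = xs#ys (v∈xs , v∈ys)

  Disjoint-++ʳ : {xs ys zs : List A} → Disjoint xs ys → Disjoint xs zs → Disjoint xs (ys ++ zs)
  Disjoint-++ʳ {ys = ys} xs#ys xs#zs (v∈xs , v∈ys++zs) with ∈-++⁻ ys v∈ys++zs
  ... | inj₁ v∈ys = xs#ys (v∈xs , v∈ys)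
  ... | inj₂ v∈zs = xs#zs (v∈xs , v∈zs)

  Disjoint-⊆ʳ : {xs ys zs : List A} → ys ⊆ zs → Disjoint xs zs → Disjoint xs ys
  Disjoint-⊆ʳ ys⊆zs xs#zs (v∈xs , v∈ys) = xs#zs (v∈xs , ys⊆zs v∈ys)

  ++-↭-insert : (xs ys zs : List A) → xs ++ ys ++ zs ↭ (xs ++ zs) ++ ys
  ++-↭-insert xs ys zs = begin
    xs ++ ys ++ zs    ↭⟨ ++⁺ˡ xs (++-comm ys zs) ⟩
    xs ++ zs ++ ys    ≡⟨ ++-assoc xs zs ys ⟨
    (xs ++ zs) ++ ys  ∎
    where open PermutationReasoning

  ++-↭-extract : (a : List A) (x : A) (b : List A) (y : A) (c : List A) →
    a ++ x ∷ b ++ y ∷ c ↭ (a ++ x ∷ c) ++ (b ++ [ y ])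
  ++-↭-extract a x b y c = begin
    a ++ x ∷ b ++ y ∷ c            ≡⟨ cong (λ t → a ++ x ∷ t) (++-assoc b [ y ] c) ⟨
    a ++ x ∷ (b ++ [ y ]) ++ c     ↭⟨ ++⁺ˡ a (↭-prep x (++-comm (b ++ [ y ]) c)) ⟩
    a ++ x ∷ c ++ b ++ [ y ]       ≡⟨ ++-assoc a (x ∷ c) _ ⟨
    (a ++ x ∷ c) ++ (b ++ [ y ])   ∎
    where open PermutationReasoning

  0<length-++-∷ : ∀ (xs : List A) {y ys} → 0 < length (xs ++ y ∷ ys)
  0<length-++-∷ [] = s≤s z≤n
  0<length-++-∷ (_ ∷ _) = s≤s z≤n

  IsEnumeration : List A → Set
  IsEnumeration xs = Unique xs × (∀ a → a ∈ xs)

  IsEnumeration-resp-↭ : {xs ys : List A} → xs ↭ ys → IsEnumeration xs → IsEnumeration ys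
  IsEnumeration-resp-↭ xs↭ys (!xs , complete) =
    Unique-resp-↭ xs↭ys !xs , λ a → ∈-resp-↭ xs↭ys (complete a)

module _ {A B : Set} (_≟_ : DecidableEquality B) (f : A → B) where

  record Repetition (xs : List A) : Set where
    constructor repetition
    field
      before between after : List A
      first second : A
      split : xs ≡ before ++ first ∷ between ++ second ∷ after
      same-image : f first ≡ f second

  Unique-map⊎Repetition : ∀ xs → Unique (map f xs) ⊎ Repetition xs
  Unique-map⊎Repetition [] = inj₁ []
  Unique-map⊎Repetition (x ∷ xs) with any? (f x ≟_) (map f xs)
  ... | yes fx∈ =
    let y , y∈xs , fx≡fy = ∈-map⁻ f fx∈
        b , c , xs≡b++y∷c = ∈-∃++ y∈xs
    in inj₂ (repetition [] b c x y (cong (x ∷_) xs≡b++y∷c) fx≡fy)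
  ... | no fx∉ with Unique-map⊎Repetition xs
  ...   | inj₁ ! = inj₁ (¬Any⇒All¬ _ fx∉ ∷ !)
  ...   | inj₂ (repetition a b c x′ y′ split same) =
    inj₂ (repetition (x ∷ a) b c x′ y′ (cong (x ∷_) split) same)

module _ {X : Set} where

  lookup⇒All : {P : X → Set} (xs : List X) → (∀ i → P (lookup xs i)) → All P xs
  lookup⇒All {P} xs p = All.tabulate (λ x∈xs → subst P (sym (lookup-index x∈xs)) (p (Any.index x∈xs)))

  All⇒lookup : {P : X → Set} {xs : List X} → All P xs → ∀ i → P (lookup xs i)
  All⇒lookup ps i = All.lookup ps (∈-lookup i)

  AllPairs⇒lookup : {R : X → X → Set} → Symmetric R → {xs : List X} → AllPairs R xs →
                    ∀ i j → i ≢ j → R (lookup xs i) (lookup xs j)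
  AllPairs⇒lookup R-sym (_ ∷ _) zero zero i≢j = contradiction refl i≢j
  AllPairs⇒lookup R-sym (Rx ∷ _) zero (suc j) _ = All⇒lookup Rx j
  AllPairs⇒lookup R-sym (Rx ∷ _) (suc i) zero _ = R-sym (All⇒lookup Rx i)
  AllPairs⇒lookup R-sym (_ ∷ Rxs) (suc i) (suc j) i≢j = AllPairs⇒lookup R-sym Rxs i j (i≢j ∘ cong suc)

module _ {X A : Set} (f : X → List A) where

  EachInExactlyOne : List X → Set
  EachInExactlyOne xs =
    ∀ a → ∃ λ i → a ∈ f (lookup xs i) × (∀ j → a ∈ f (lookup xs j) → j ≡ i)

  ∈-concatMap⇒lookup : ∀ xs {a} → a ∈ concatMap f xs → ∃ λ i → a ∈ f (lookup xs i)
  ∈-concatMap⇒lookup xs a∈ = let p = ∈-concatMap⁻ f {xs = xs} a∈ in Any.index p , lookup-index p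

  lookup⇒∈-concatMap : ∀ xs i {a} → a ∈ f (lookup xs i) → a ∈ concatMap f xs
  lookup⇒∈-concatMap xs i a∈ = ∈-concatMap⁺ f {xs = xs} (lose (∈-lookup i) a∈)

  Unique-concatMap⇒lookup : ∀ xs → Unique (concatMap f xs) → ∀ i → Unique (f (lookup xs i))
  Unique-concatMap⇒lookup (x ∷ xs) ! i with Unique-++⁻ (f x) ! | i
  ... | !x , _ , _ | zero = !x
  ... | _ , !xs , _ | suc i′ = Unique-concatMap⇒lookup xs !xs i′

  Unique-concatMap⇒lookup-injective : ∀ xs → Unique (concatMap f xs) →
    ∀ {a} i j → a ∈ f (lookup xs i) → a ∈ f (lookup xs j) → i ≡ j
  Unique-concatMap⇒lookup-injective (x ∷ xs) ! i j a∈i a∈j with Unique-++⁻ (f x) !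
  ... | _ , !xs , x#xs with i | j
  ...   | zero  | zero  = refl
  ...   | zero  | suc j′ = contradiction (a∈i , lookup⇒∈-concatMap xs j′ a∈j) x#xs
  ...   | suc i′ | zero  = contradiction (a∈j , lookup⇒∈-concatMap xs i′ a∈i) x#xs
  ...   | suc i′ | suc j′ = cong suc (Unique-concatMap⇒lookup-injective xs !xs i′ j′ a∈i a∈j)

  lookup-injective⇒Unique-concatMap : ∀ xs → (∀ i → Unique (f (lookup xs i))) →
    (∀ {a} i j → a ∈ f (lookup xs i) → a ∈ f (lookup xs j) → i ≡ j) → Unique (concatMap f xs)
  lookup-injective⇒Unique-concatMap [] _ _ = []
  lookup-injective⇒Unique-concatMap (x ∷ xs) ! injective =
    Unique.++⁺ (! zero) (lookup-injective⇒Unique-concatMap xs (! ∘ suc) injective′) x#xs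
    where
    injective′ : ∀ {a} i j → a ∈ f (lookup xs i) → a ∈ f (lookup xs j) → i ≡ j
    injective′ i j a∈i a∈j = suc-injective (injective (suc i) (suc j) a∈i a∈j)
    x#xs : Disjoint (f x) (concatMap f xs)
    x#xs (a∈x , a∈xs) with ∈-concatMap⇒lookup xs a∈xs
    ... | j , a∈j with injective zero (suc j) a∈x a∈j
    ... | ()

  EachInExactlyOne⇒IsEnumeration : ∀ xs → (∀ i → Unique (f (lookup xs i))) →
    EachInExactlyOne xs → IsEnumeration (concatMap f xs)
  EachInExactlyOne⇒IsEnumeration xs ! exactlyOne =
    lookup-injective⇒Unique-concatMap xs ! injective ,
    λ a → let i , a∈i , _ = exactlyOne a in lookup⇒∈-concatMap xs i a∈i
    where
    injective : ∀ {a} i j → a ∈ f (lookup xs i) → a ∈ f (lookup xs j) → i ≡ j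
    injective {a} i j a∈i a∈j = let _ , _ , only = exactlyOne a in trans (only i a∈i) (sym (only j a∈j))

  IsEnumeration⇒EachInExactlyOne : ∀ xs → IsEnumeration (concatMap f xs) → EachInExactlyOne xs
  IsEnumeration⇒EachInExactlyOne xs (! , complete) a =
    let i , a∈i = ∈-concatMap⇒lookup xs (complete a)
    in i , a∈i , λ j a∈j → Unique-concatMap⇒lookup-injective xs ! j i a∈j a∈i

module _ (H : Hypergraph) where

  open import Data.List.Membership.DecPropositional (Fin._≟_ {Hypergraph.nV H}) using (_∈?_)

  Step : Set
  Step = Edge H × Vertex H

  IsLoopFrom : Vertex H → List Step → Set
  IsLoopFrom u s = IsWalkFrom H u s × lastAnchorFrom H u s ≡ u

  lastAnchorFrom-++ : ∀ u s t →
    lastAnchorFrom H u (s ++ t) ≡ lastAnchorFrom H (lastAnchorFrom H u s) t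
  lastAnchorFrom-++ u [] t = refl
  lastAnchorFrom-++ u ((e , v) ∷ s) t = lastAnchorFrom-++ v s t

  IsWalkFrom-++⁻ : ∀ u s {t} → IsWalkFrom H u (s ++ t) →
    IsWalkFrom H u s × IsWalkFrom H (lastAnchorFrom H u s) t
  IsWalkFrom-++⁻ u [] w = done , w
  IsWalkFrom-++⁻ u ((e , v) ∷ s) (step u≢v u∈e v∈e w) =
    let ws , wt = IsWalkFrom-++⁻ v s w in step u≢v u∈e v∈e ws , wt

  IsWalkFrom-++⁺ : ∀ {u} s {t} → IsWalkFrom H u s → IsWalkFrom H (lastAnchorFrom H u s) t →
    IsWalkFrom H u (s ++ t)
  IsWalkFrom-++⁺ [] done wt = wt
  IsWalkFrom-++⁺ (_ ∷ s) (step u≢v u∈e v∈e ws) wt = step u≢v u∈e v∈e (IsWalkFrom-++⁺ s ws wt)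

  lastAnchorFrom-excise : ∀ u s r t → lastAnchorFrom H (lastAnchorFrom H u s) r ≡ lastAnchorFrom H u s →
    lastAnchorFrom H u (s ++ r ++ t) ≡ lastAnchorFrom H u (s ++ t)
  lastAnchorFrom-excise u s r t returns = begin
    lastAnchorFrom H u (s ++ r ++ t)            ≡⟨ lastAnchorFrom-++ u s (r ++ t) ⟩
    lastAnchorFrom H v (r ++ t)                 ≡⟨ lastAnchorFrom-++ v r t ⟩
    lastAnchorFrom H (lastAnchorFrom H v r) t   ≡⟨ cong (λ v′ → lastAnchorFrom H v′ t) returns ⟩
    lastAnchorFrom H v t                        ≡⟨ lastAnchorFrom-++ u s t ⟨
    lastAnchorFrom H u (s ++ t)                 ∎
    where
    open ≡-Reasoning
    v = lastAnchorFrom H u s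

  IsWalkFrom-insert : ∀ {u} s {r t} → IsLoopFrom (lastAnchorFrom H u s) r →
    IsWalkFrom H u (s ++ t) → IsWalkFrom H u (s ++ r ++ t)
  IsWalkFrom-insert {u} s {r} (wr , returns) w =
    let ws , wt = IsWalkFrom-++⁻ u s w
    in IsWalkFrom-++⁺ s ws (IsWalkFrom-++⁺ r wr (subst (λ v → IsWalkFrom H v _) (sym returns) wt))

  IsLoopFrom-rotate : ∀ {u} s {t} → IsLoopFrom u (s ++ t) → IsLoopFrom (lastAnchorFrom H u s) (t ++ s)
  IsLoopFrom-rotate {u} s {t} (w , closed) =
    IsWalkFrom-++⁺ t wt (subst (λ v → IsWalkFrom H v s) (sym returns) ws) ,
    trans (lastAnchorFrom-++ _ t s) (cong (λ v → lastAnchorFrom H v s) returns)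
    where
    ws = proj₁ (IsWalkFrom-++⁻ u s w)
    wt = proj₂ (IsWalkFrom-++⁻ u s w)
    returns : lastAnchorFrom H (lastAnchorFrom H u s) t ≡ u
    returns = trans (sym (lastAnchorFrom-++ u s t)) closed

  split-at-anchor : ∀ u s {v} → v ∈ anchors H (walk u s) →
    ∃ λ p → ∃ λ q → s ≡ p ++ q × lastAnchorFrom H u p ≡ v
  split-at-anchor u s (here refl) = [] , s , refl , refl
  split-at-anchor u ((e , w) ∷ s) (there v∈) =
    let p , q , s≡p++q , ends = split-at-anchor w s v∈
    in (e , w) ∷ p , q , cong ((e , w) ∷_) s≡p++q , ends

  IsClosedWalk⇒IsLoopFrom : ∀ {u s} → IsClosedWalk H (walk u s) → IsLoopFrom u s
  IsClosedWalk⇒IsLoopFrom (w , _ , closed) = w , closed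

  -- A loop cannot have exactly one step, since consecutive anchors differ.
  IsLoopFrom⇒IsClosedWalk : ∀ {u x s} → IsLoopFrom u (x ∷ s) → IsClosedWalk H (walk u (x ∷ s))
  IsLoopFrom⇒IsClosedWalk {s = []} (step u≢v _ _ done , closed) = contradiction (sym closed) u≢v
  IsLoopFrom⇒IsClosedWalk {s = _ ∷ _} (w , closed) = w , s≤s (s≤s z≤n) , closed

  splice : ∀ {u u′ s s′ v} → IsClosedWalk H (walk u s) → IsClosedWalk H (walk u′ s′) →
    v ∈ anchors H (walk u s) → v ∈ anchors H (walk u′ s′) →
    ∃ λ s″ → IsClosedWalk H (walk u s″) × s″ ↭ s ++ s′
  splice {u} {u′} {s} {s′} (wT , 2≤∣s∣ , closedT) W v∈T v∈W
    with split-at-anchor u s v∈T | split-at-anchor u′ s′ v∈W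
  ... | p , q , refl , refl | p′ , q′ , refl , same =
    p ++ r ++ q , (wS , 2≤∣S∣ , closedS) , S↭T++W
    where
    r = q′ ++ p′
    loop : IsLoopFrom (lastAnchorFrom H u p) r
    loop = subst (λ v → IsLoopFrom v r) same (IsLoopFrom-rotate p′ (IsClosedWalk⇒IsLoopFrom W))
    wS = IsWalkFrom-insert p loop wT
    closedS = trans (lastAnchorFrom-excise u p r q (proj₂ loop)) closedT
    S↭T++W : p ++ r ++ q ↭ (p ++ q) ++ (p′ ++ q′)
    S↭T++W = ↭-trans (++-↭-insert p r q) (++⁺ˡ (p ++ q) (++-comm q′ p′))
    2≤∣S∣ : 2 ≤ length (p ++ r ++ q)
    2≤∣S∣ = ≤-trans 2≤∣s∣ (≤-trans (m≤m+n _ _)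
              (≤-reflexive (sym (trans (↭-length S↭T++W) (length-++ (p ++ q))))))

  IsLoopFrom-excise-repetition : ∀ {u} a {e₁ v} b {e₂} c →
    IsLoopFrom u (a ++ (e₁ , v) ∷ b ++ (e₂ , v) ∷ c) →
    IsLoopFrom u (a ++ (e₁ , v) ∷ c) × IsLoopFrom v (b ++ [ e₂ , v ])
  IsLoopFrom-excise-repetition {u} a {e₁} {v} b {e₂} c (w , closed)
    with IsWalkFrom-++⁻ u a w
  ... | wa , step ≢₁ x∈e₁ v∈e₁ wbc with IsWalkFrom-++⁻ v b wbc
  ...   | wb , step ≢₂ y∈e₂ v∈e₂ wc =
    (IsWalkFrom-++⁺ a wa (step ≢₁ x∈e₁ v∈e₁ wc) , closed′) ,
    (IsWalkFrom-++⁺ b wb (step ≢₂ y∈e₂ v∈e₂ done) , lastAnchorFrom-++ v b _)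
    where
    closed′ : lastAnchorFrom H u (a ++ (e₁ , v) ∷ c) ≡ u
    closed′ = begin
      lastAnchorFrom H u (a ++ (e₁ , v) ∷ c)                   ≡⟨ lastAnchorFrom-++ u a _ ⟩
      lastAnchorFrom H v c                                     ≡⟨ lastAnchorFrom-++ v b _ ⟨
      lastAnchorFrom H v (b ++ (e₂ , v) ∷ c)                   ≡⟨ lastAnchorFrom-++ u a _ ⟨
      lastAnchorFrom H u (a ++ (e₁ , v) ∷ b ++ (e₂ , v) ∷ c)   ≡⟨ closed ⟩
      u                                                        ∎
      where open ≡-Reasoning

  allSteps : List (Walk H) → List Step
  allSteps = concatMap Walk.steps

  IsSimpleClosedWalk : Walk H → Set
  IsSimpleClosedWalk X = IsClosedWalk H X × Unique (map proj₂ (Walk.steps X))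

  SimpleClosedDecomposition : List Step → Set
  SimpleClosedDecomposition s = ∃ λ Cs → All IsSimpleClosedWalk Cs × allSteps Cs ↭ s

  SimpleClosedDecomposition-++ : ∀ {s t} → SimpleClosedDecomposition s → SimpleClosedDecomposition t →
    SimpleClosedDecomposition (s ++ t)
  SimpleClosedDecomposition-++ (Cs , simple , Cs↭s) (Ds , simple′ , Ds↭t) =
    Cs ++ Ds , All.++⁺ simple simple′ ,
    ↭-trans (↭-reflexive (concatMap-++ Walk.steps Cs Ds)) (++⁺ Cs↭s Ds↭t)

  SimpleClosedDecomposition-resp-↭ : ∀ {s t} → s ↭ t →
    SimpleClosedDecomposition s → SimpleClosedDecomposition t
  SimpleClosedDecomposition-resp-↭ s↭t (Cs , simple , Cs↭s) = Cs , simple , ↭-trans Cs↭s s↭t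

  simpleLoop-decomposition : ∀ {u} s → IsLoopFrom u s → Unique (map proj₂ s) → SimpleClosedDecomposition s
  simpleLoop-decomposition [] _ _ = [] , [] , ↭-refl
  simpleLoop-decomposition {u} s@(_ ∷ _) loop ! =
    walk u s ∷ [] , (IsLoopFrom⇒IsClosedWalk loop , !) ∷ [] , ↭-reflexive (++-identityʳ s)

  loop-decomposition : ∀ {u} s → IsLoopFrom u s → SimpleClosedDecomposition s
  loop-decomposition s = decompose s (<-wellFounded (length s))
    where
    decompose : ∀ {u} s → Acc _<_ (length s) → IsLoopFrom u s → SimpleClosedDecomposition s
    decompose s (acc smaller) loop with Unique-map⊎Repetition Fin._≟_ proj₂ s
    ... | inj₁ ! = simpleLoop-decomposition s loop !
    ... | inj₂ (repetition a b c (e₁ , v) (e₂ , _) refl refl) =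
      SimpleClosedDecomposition-resp-↭ (↭-sym s↭P++R)
        (SimpleClosedDecomposition-++ (decompose P (smaller ∣P∣<∣s∣) loopP)
                                      (decompose R (smaller ∣R∣<∣s∣) loopR))
      where
      P = a ++ (e₁ , v) ∷ c
      R = b ++ [ e₂ , v ]
      loopP = proj₁ (IsLoopFrom-excise-repetition a b c loop)
      loopR = proj₂ (IsLoopFrom-excise-repetition a b c loop)
      s↭P++R = ++-↭-extract a (e₁ , v) b (e₂ , v) c
      ∣s∣≡ : length (a ++ (e₁ , v) ∷ b ++ (e₂ , v) ∷ c) ≡ length P + length R
      ∣s∣≡ = trans (↭-length s↭P++R) (length-++ P)
      ∣P∣<∣s∣ = subst (length P <_) (sym ∣s∣≡) (m<m+n (length P) (0<length-++-∷ b))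
      ∣R∣<∣s∣ = subst (length R <_) (sym ∣s∣≡) (m<n+m (length R) (0<length-++-∷ a))

  take-length-anchors : ∀ u s →
    take (length s) (anchors H (walk u s)) ++ [ lastAnchorFrom H u s ] ≡ anchors H (walk u s)
  take-length-anchors u [] = refl
  take-length-anchors u ((e , v) ∷ s) = cong (u ∷_) (take-length-anchors v s)

  -- For a closed walk, v₀ … v_{k-1} is a rotation of v₁ … v_k.
  take-length-anchors-↭ : ∀ {u} s → lastAnchorFrom H u s ≡ u →
    map proj₂ s ↭ take (length s) (anchors H (walk u s))
  take-length-anchors-↭ {u} s closed = drop-∷ (begin
    u ∷ map proj₂ s                       ≡⟨ take-length-anchors u s ⟨
    firstAnchors ++ [ lastAnchorFrom H u s ] ≡⟨ cong (λ v → firstAnchors ++ [ v ]) closed ⟩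
    firstAnchors ++ [ u ]                 ↭⟨ ∷↭∷ʳ u firstAnchors ⟨
    u ∷ firstAnchors                      ∎)
    where
    open PermutationReasoning
    firstAnchors = take (length s) (anchors H (walk u s))

  IsSimpleClosedWalk⇒IsCycle : ∀ {X} → IsSimpleClosedWalk X → Unique (edges H X) → IsCycle H X
  IsSimpleClosedWalk⇒IsCycle {walk u s} (closed , !anchors) !edges =
    closed , Unique-resp-↭ (take-length-anchors-↭ s (proj₂ (proj₂ closed))) !anchors , !edges

  closedWalks-decomposition : ∀ F → All (IsClosedWalk H) F → SimpleClosedDecomposition (allSteps F)
  closedWalks-decomposition [] [] = [] , [] , ↭-refl
  closedWalks-decomposition (walk u s ∷ F) (closed ∷ closeds) =
    SimpleClosedDecomposition-++ (loop-decomposition s (IsClosedWalk⇒IsLoopFrom closed))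
                                 (closedWalks-decomposition F closeds)

  allEdges : List (Walk H) → List (Edge H)
  allEdges = concatMap (edges H)

  allSteps-↭⇒allEdges-↭ : ∀ {F G} → allSteps F ↭ allSteps G → allEdges F ↭ allEdges G
  allSteps-↭⇒allEdges-↭ {F} {G} F↭G = begin
    allEdges F                   ≡⟨ map-concatMap proj₁ Walk.steps F ⟨
    map proj₁ (allSteps F)       ↭⟨ map⁺ proj₁ F↭G ⟩
    map proj₁ (allSteps G)       ≡⟨ map-concatMap proj₁ Walk.steps G ⟩
    allEdges G                   ∎
    where open PermutationReasoning

  IsEdgePartition : List (Walk H) → Set
  IsEdgePartition F = (∀ i → Unique (edges H (lookup F i))) × EachEdgeInExactlyOne H F

  IsEdgePartition-resp-↭ : ∀ {F G} → allSteps F ↭ allSteps G → IsEdgePartition F → IsEdgePartition G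
  IsEdgePartition-resp-↭ {F} {G} F↭G (! , exactlyOne) =
    Unique-concatMap⇒lookup (edges H) G (proj₁ enumeration) ,
    IsEnumeration⇒EachInExactlyOne (edges H) G enumeration
    where
    enumeration : IsEnumeration (allEdges G)
    enumeration = IsEnumeration-resp-↭ (allSteps-↭⇒allEdges-↭ {F} {G} F↭G)
                    (EachInExactlyOne⇒IsEnumeration (edges H) F ! exactlyOne)

  quasiEulerian⇒cycleDecomposition : QuasiEulerian H → HasCycleDecomposition H
  quasiEulerian⇒cycleDecomposition (F , trails , _ , exactlyOne) =
    let Cs , simple , Cs↭F = closedWalks-decomposition F (lookup⇒All F (proj₁ ∘ trails))
        !edges , exactlyOne′ = IsEdgePartition-resp-↭ {F} {Cs} (↭-sym Cs↭F) (proj₂ ∘ trails , exactlyOne)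
    in Cs , (λ i → IsSimpleClosedWalk⇒IsCycle (All⇒lookup simple i) (!edges i)) , exactlyOne′

  allAnchors : List (Walk H) → List (Vertex H)
  allAnchors = concatMap (anchors H)

  AnchorDisjoint : Walk H → Walk H → Set
  AnchorDisjoint X Y = Disjoint (anchors H X) (anchors H Y)

  anchors-⊆-allAnchors : ∀ {X F} → X ∈ F → anchors H X ⊆ allAnchors F
  anchors-⊆-allAnchors X∈F v∈X = ∈-concatMap⁺ (anchors H) (lose X∈F v∈X)

  anchors-resp-↭ : ∀ {u u′ s s′ s″} → s″ ↭ s ++ s′ →
    anchors H (walk u s″) ⊆ anchors H (walk u s) ++ anchors H (walk u′ s′)
  anchors-resp-↭ _ (here refl) = here refl
  anchors-resp-↭ {u} {u′} {s} {s′} s″↭ (there v∈s″)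
    with ∈-++⁻ (map proj₂ s) (∈-resp-↭ (↭-trans (map⁺ proj₂ s″↭) (↭-reflexive (map-++ proj₂ s s′)))
                                        v∈s″)
  ... | inj₁ v∈s = there (∈-++⁺ˡ v∈s)
  ... | inj₂ v∈s′ = ∈-++⁺ʳ (u ∷ map proj₂ s) (there v∈s′)

  record Insertion (T : Walk H) (L : List (Walk H)) : Set where
    field
      family : List (Walk H)
      closed : All (IsClosedWalk H) family
      disjoint : AllPairs AnchorDisjoint family
      steps-↭ : allSteps family ↭ Walk.steps T ++ allSteps L
      anchors-⊆ : allAnchors family ⊆ anchors H T ++ allAnchors L

  -- T is spliced into every member of L it meets; the anchors-⊆ invariant keeps
  -- the members of L that T misses disjoint from the result.
  insert : ∀ {T} → IsClosedWalk H T → ∀ {L} → All (IsClosedWalk H) L → AllPairs AnchorDisjoint L →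
    Insertion T L
  insert {T} closedT {[]} [] [] = record
    { family = T ∷ [] ; closed = closedT ∷ [] ; disjoint = [] ∷ []
    ; steps-↭ = ↭-refl ; anchors-⊆ = λ v∈ → v∈ }
  insert {T} closedT {W ∷ L} (closedW ∷ closedL) (W#L ∷ disjointL)
    with any? (_∈? anchors H W) (anchors H T)
  ... | yes meet =
    let v , v∈T , v∈W = find meet
        s″ , closedS , s″↭ = splice closedT closedW v∈T v∈W
        open Insertion (insert closedS closedL disjointL)
    in record
      { family = family ; closed = closed ; disjoint = disjoint
      ; steps-↭ = ↭-trans steps-↭ (↭-trans (++⁺ʳ (allSteps L) s″↭)
                    (↭-reflexive (++-assoc (Walk.steps T) (Walk.steps W) (allSteps L))))
      ; anchors-⊆ = ⊆-trans anchors-⊆ (⊆-trans (Subset.++⁺ˡ (allAnchors L) (anchors-resp-↭ s″↭))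
                      (⊆-reflexive (++-assoc (anchors H T) (anchors H W) (allAnchors L))))
      }
  ... | no miss =
    let open Insertion (insert closedT closedL disjointL)
        W#T++L : Disjoint (anchors H W) (anchors H T ++ allAnchors L)
        W#T++L = Disjoint-++ʳ (Disjoint.sym (λ (v∈T , v∈W) → miss (lose v∈T v∈W)))
                              (Disjoint.concat⁺ʳ (All.map⁺ W#L))
    in record
      { family = W ∷ family ; closed = closedW ∷ closed
      ; disjoint =
          All.tabulate (λ Y∈ → Disjoint-⊆ʳ (⊆-trans (anchors-⊆-allAnchors Y∈) anchors-⊆) W#T++L)
          ∷ disjoint
      ; steps-↭ = ↭-trans (++⁺ˡ (Walk.steps W) steps-↭) (shifts (Walk.steps W) (Walk.steps T))
      ; anchors-⊆ = ⊆-trans (Subset.++⁺ʳ (anchors H W) anchors-⊆)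
                      (⊆-reflexive-↭ (shifts (anchors H W) (anchors H T)))
      }

  merge : ∀ C → All (IsClosedWalk H) C →
    ∃ λ R → All (IsClosedWalk H) R × AllPairs AnchorDisjoint R × allSteps R ↭ allSteps C
  merge [] [] = [] , [] , [] , ↭-refl
  merge (T ∷ C) (closedT ∷ closedC) =
    let R , closedR , disjointR , R↭C = merge C closedC
        open Insertion (insert closedT closedR disjointR)
    in family , closed , disjoint , ↭-trans steps-↭ (++⁺ˡ (Walk.steps T) R↭C)

  cycleDecomposition⇒quasiEulerian : HasCycleDecomposition H → QuasiEulerian H
  cycleDecomposition⇒quasiEulerian (C , cycles , exactlyOne) =
    let R , closed , disjoint , R↭C = merge C (lookup⇒All C (proj₁ ∘ cycles))
        !edges , exactlyOne′ =
          IsEdgePartition-resp-↭ {C} {R} (↭-sym R↭C) (proj₂ ∘ proj₂ ∘ cycles , exactlyOne)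
    in R , (λ i → All⇒lookup closed i , !edges i) ,
       (λ i j i≢j v v∈i v∈j → AllPairs⇒lookup Disjoint.sym disjoint i j i≢j (v∈i , v∈j)) ,
       exactlyOne′

mainTheorem19 : (H : Hypergraph) → QuasiEulerian H ⇔ HasCycleDecomposition H
mainTheorem19 H = mk⇔ (quasiEulerian⇒cycleDecomposition H) (cycleDecomposition⇒quasiEulerian H)
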